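{- Let $\mathbf{A}$ be a Heyting algebra, $\mathbf{B}=s(\mathbf{A})$, and $\Delta$ an ideal of $\mathbf{A}$. Then $\sigma(\Delta)\cap A=N(\Delta)$.
   Context: A topological Boolean algebra (TBA) is an algebra $\langle B;\vee,\wedge,\to,\bot,\Box\rangle$ whose reduct is a Boolean algebra ($\neg_{\mathbf{B}}a:=a\to\bot$) with $\Box 1=1$, $\Box(a\wedge b)=\Box a\wedge\Box b$, $\Box a\le a$, $\Box a\le\Box\Box a$; $\Diamond a:=\neg_{\mathbf{B}}\Box\neg_{\mathbf{B}}a$. Its open elements $\{a:\Box a=a\}$ form a Heyting algebra $\mathcal{G}(\mathbf{B})$ with $\vee,\wedge,\bot$ of $\mathbf{B}$ and implication $\Box(a\to b)$. For a Heyting algebra $\mathbf{A}$, $s(\mathbf{A})$ denotes the TBA $\mathbf{B}$ (unique up to isomorphism) such that $\mathcal{G}(\mathbf{B})=\mathbf{A}$ (so $A\subseteq B$ is the set of open elements) and $\mathbf{B}$ is generated by its open elements. In $\mathbf{A}$, $\neg a:=a\to\bot$. For an ideal $\Delta$ of $\mathbf{A}$: $\sigma(\Delta)=\{x\in B: x\le\Diamond y\text{ for some }y\in\Delta\}$ (the least closed ideal of $\mathbf{B}$ containing $\Delta$), and $N(\Delta)=\{a\in A: a\le\neg\neg b\text{ for some }b\in\Delta\}$. -}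

module Defs where

open import Level using (Level; _⊔_; suc)
open import Data.Product using (Σ; ∃; _×_; _,_)
open import Relation.Unary using (Pred)
open import Relation.Binary.Lattice.Bundles using (HeytingAlgebra; BooleanAlgebra)

record TBA (c ℓ₁ ℓ₂ : Level) : Set (suc (c ⊔ ℓ₁ ⊔ ℓ₂)) where
  field
    boolean : BooleanAlgebra c ℓ₁ ℓ₂
  open BooleanAlgebra boolean public
  field
    □          : Carrier → Carrier
    □-cong     : ∀ {x y} → x ≈ y → □ x ≈ □ y
    □-⊤        : □ ⊤ ≈ ⊤
    □-∧        : ∀ x y → □ (x ∧ y) ≈ □ x ∧ □ y
    □-deflat   : ∀ x → □ x ≤ x
    □-idem     : ∀ x → □ x ≤ □ (□ x)

  infixr 5 _⇒_
  _⇒_ : Carrier → Carrier → Carrier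
  x ⇒ y = (¬ x) ∨ y

  ¬B : Carrier → Carrier
  ¬B a = a ⇒ ⊥

  ◇ : Carrier → Carrier
  ◇ a = ¬B (□ (¬B a))

  IsOpen : Pred Carrier ℓ₁
  IsOpen a = □ a ≈ a

  data Generated : Pred Carrier (c ⊔ ℓ₁) where
    gen-open : ∀ {x} → IsOpen x → Generated x
    gen-⊥    : Generated ⊥
    gen-∨    : ∀ {x y} → Generated x → Generated y → Generated (x ∨ y)
    gen-∧    : ∀ {x y} → Generated x → Generated y → Generated (x ∧ y)
    gen-⇒    : ∀ {x y} → Generated x → Generated y → Generated (x ⇒ y)
    gen-□    : ∀ {x} → Generated x → Generated (□ x)
    gen-≈    : ∀ {x y} → x ≈ y → Generated x → Generated y

  GeneratedByOpens : Set (c ⊔ ℓ₁)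
  GeneratedByOpens = ∀ x → Generated x

-- "B = s(A)": e : A → B identifies the Heyting algebra A with the
-- Heyting algebra G(B) of open elements of B (an isomorphism onto the
-- open elements, with implication □(x ⇒ y)), and B is generated by
-- its open elements.

module _ {a a₁ a₂ b b₁ b₂ : Level}
         (A : HeytingAlgebra a a₁ a₂) (B : TBA b b₁ b₂) where
  private
    module A = HeytingAlgebra A
    module B = TBA B

  record IsSOf (e : A.Carrier → B.Carrier) : Set (a ⊔ a₁ ⊔ a₂ ⊔ b ⊔ b₁ ⊔ b₂) where
    field
      e-cong    : ∀ {x y} → x A.≈ y → e x B.≈ e y
      e-inj     : ∀ {x y} → e x B.≈ e y → x A.≈ y
      e-mono    : ∀ {x y} → x A.≤ y → e x B.≤ e y
      e-reflect : ∀ {x y} → e x B.≤ e y → x A.≤ y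
      e-∨       : ∀ x y → e (x A.∨ y) B.≈ (e x B.∨ e y)
      e-∧       : ∀ x y → e (x A.∧ y) B.≈ (e x B.∧ e y)
      e-⊥       : e A.⊥ B.≈ B.⊥
      e-⊤       : e A.⊤ B.≈ B.⊤
      e-⇨       : ∀ x y → e (x A.⇨ y) B.≈ B.□ (e x B.⇒ e y)
      e-open    : ∀ x → B.IsOpen (e x)
      e-onto    : ∀ y → B.IsOpen y → ∃ λ x → e x B.≈ y
      generated : B.GeneratedByOpens

module _ {a a₁ a₂ : Level} (A : HeytingAlgebra a a₁ a₂) where
  private
    module A = HeytingAlgebra A

  record IsIdeal {p : Level} (Δ : Pred A.Carrier p) : Set (a ⊔ a₂ ⊔ p) where
    field
      ⊥∈     : Δ A.⊥
      ↓-closed : ∀ {x y} → x A.≤ y → Δ y → Δ x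
      ∨-closed : ∀ {x y} → Δ x → Δ y → Δ (x A.∨ y)

  ¬H : A.Carrier → A.Carrier
  ¬H x = x A.⇨ A.⊥

  N : {p : Level} → Pred A.Carrier p → Pred A.Carrier (a ⊔ a₂ ⊔ p)
  N Δ x = ∃ λ y → Δ y × (x A.≤ ¬H (¬H y))

σ : {a a₁ a₂ b b₁ b₂ p : Level}
    (A : HeytingAlgebra a a₁ a₂) (B : TBA b b₁ b₂)
    (e : HeytingAlgebra.Carrier A → TBA.Carrier B) →
    Pred (HeytingAlgebra.Carrier A) p → Pred (TBA.Carrier B) (a ⊔ b₂ ⊔ p)
σ A B e Δ x = ∃ λ y → Δ y × (TBA._≤_ B x (TBA.◇ B (e y)))

module Submission where

open import Defs
open import Level using (Level)
open import Data.Product using (_×_; _,_; map₂)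
open import Relation.Unary using (Pred)
open import Relation.Binary.Lattice.Bundles using (HeytingAlgebra; BooleanAlgebra)
import Relation.Binary.Lattice.Properties.HeytingAlgebra as HeytingAlgebraProperties

-- The Heyting double negation ¬¬y of A is computed in B as □◇y.  An open
-- element lies below ◇y iff it lies below the interior □◇y, so an element
-- of A is below ◇y in B iff it is below ¬¬y in A.

module TBAProperties {c ℓ₁ ℓ₂ : Level} (B : TBA c ℓ₁ ℓ₂) where
  open TBA B

  □-mono : ∀ {x y} → x ≤ y → □ x ≤ □ y
  □-mono {x} {y} x≤y = begin
    □ x           ≈⟨ □-cong (antisym (∧-greatest refl x≤y) (x∧y≤x x y)) ⟩
    □ (x ∧ y)     ≈⟨ □-∧ x y ⟩
    □ x ∧ □ y     ≤⟨ x∧y≤y (□ x) (□ y) ⟩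
    □ y           ∎
    where open import Relation.Binary.Reasoning.PartialOrder poset

  open-≤-□ : ∀ {u x} → IsOpen u → u ≤ x → u ≤ □ x
  open-≤-□ {u} {x} u-open u≤x = trans (reflexive (Eq.sym u-open)) (□-mono u≤x)

module SOfProperties {a a₁ a₂ b b₁ b₂ : Level}
    (A : HeytingAlgebra a a₁ a₂) (B : TBA b b₁ b₂)
    (e : HeytingAlgebra.Carrier A → TBA.Carrier B) (s : IsSOf A B e) where
  private
    module A = HeytingAlgebra A
    module B = TBA B
    open IsSOf s
    open HeytingAlgebraProperties (BooleanAlgebra.heytingAlgebra B.boolean)
      using (⇨-cong)
  open TBAProperties B

  e-¬ : ∀ x → e (¬H A x) B.≈ B.□ (B.¬B (e x))
  e-¬ x = B.Eq.trans (e-⇨ x A.⊥) (B.□-cong (⇨-cong B.Eq.refl e-⊥))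

  e-¬¬ : ∀ x → e (¬H A (¬H A x)) B.≈ B.□ (B.◇ (e x))
  e-¬¬ x = B.Eq.trans (e-⇨ (¬H A x) A.⊥) (B.□-cong (⇨-cong (e-¬ x) e-⊥))

  ≤◇⇒≤¬¬ : ∀ {x y} → e x B.≤ B.◇ (e y) → x A.≤ ¬H A (¬H A y)
  ≤◇⇒≤¬¬ {x} {y} ex≤◇ey = e-reflect (begin
    e x                  ≤⟨ open-≤-□ (e-open x) ex≤◇ey ⟩
    B.□ (B.◇ (e y))      ≈⟨ e-¬¬ y ⟨
    e (¬H A (¬H A y))    ∎)
    where open import Relation.Binary.Reasoning.PartialOrder B.poset

  ≤¬¬⇒≤◇ : ∀ {x y} → x A.≤ ¬H A (¬H A y) → e x B.≤ B.◇ (e y)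
  ≤¬¬⇒≤◇ {x} {y} x≤¬¬y = begin
    e x                  ≤⟨ e-mono x≤¬¬y ⟩
    e (¬H A (¬H A y))    ≈⟨ e-¬¬ y ⟩
    B.□ (B.◇ (e y))      ≤⟨ B.□-deflat (B.◇ (e y)) ⟩
    B.◇ (e y)            ∎
    where open import Relation.Binary.Reasoning.PartialOrder B.poset

lemma3p3p1 : {a a₁ a₂ b b₁ b₂ p : Level}
    (A : HeytingAlgebra a a₁ a₂) (B : TBA b b₁ b₂)
    (e : HeytingAlgebra.Carrier A → TBA.Carrier B) → IsSOf A B e →
    (Δ : Pred (HeytingAlgebra.Carrier A) p) → IsIdeal A Δ →
    (∀ x → (σ A B e Δ (e x) → N A Δ x) × (N A Δ x → σ A B e Δ (e x)))
lemma3p3p1 A B e s Δ _ x =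
  map₂ (map₂ ≤◇⇒≤¬¬) , map₂ (map₂ ≤¬¬⇒≤◇)
  where open SOfProperties A B e s
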